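{- For every natural number $n\geq 2$, the class $RTA_n$ is not a variety (i.e. it is not closed under homomorphic images, equivalently it is not axiomatizable by equations).
   Context: For a set $U$, ${}^nU$ is the set of maps $n=\{0,\dots,n-1\}\to U$; for $i\neq j\in n$, $[i,j]$ is the transposition of $n$ swapping $i,j$. The full transposition set algebra of dimension $n$ with base $U$ is $\langle\mathcal{P}({}^nU);\cap,\sim,S_{ij}\rangle_{i\neq j\in n}$, where $\sim$ is complement w.r.t. ${}^nU$ and $S_{ij}(X)=\{q\in{}^nU:q\circ[i,j]\in X\}$. $SetTA_n$ is the class of all subalgebras of full transposition set algebras of dimension $n$, and $RTA_n=\mathbf{SP}\,SetTA_n$, where $\mathbf{S}$ and $\mathbf{P}$ denote closure under (isomorphic copies of) subalgebras and direct products. -}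

module Defs where

open import Level using (0ℓ) renaming (suc to lsuc)
open import Data.Nat using (ℕ)
open import Data.Fin using (Fin)
open import Data.Fin.Permutation.Components using (transpose)
open import Data.Product using (Σ; _×_; _,_)
open import Data.Empty using (⊥)
open import Relation.Nullary using (¬_)
open import Relation.Binary.PropositionalEquality using (_≡_; _≢_)
open import Relation.Binary.Structures using (IsEquivalence)
open import Function using (_∘_)

record TA (n : ℕ) : Set₂ where
  infixr 7 _∩_
  infix 4 _≈_
  field
    Carrier : Set₁
    _≈_     : Carrier → Carrier → Set
    isEquivalence : IsEquivalence _≈_
    _∩_ : Carrier → Carrier → Carrier
    ∼_  : Carrier → Carrier
    S   : (i j : Fin n) → i ≢ j → Carrier → Carrier
    ∩-cong : ∀ {x x' y y'} → x ≈ x' → y ≈ y' → (x ∩ y) ≈ (x' ∩ y')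
    ∼-cong : ∀ {x x'} → x ≈ x' → (∼ x) ≈ (∼ x')
    S-cong : ∀ i j (p : i ≢ j) {x x'} → x ≈ x' → S i j p x ≈ S i j p x'

open TA

record IsHom {n : ℕ} (A B : TA n) (h : Carrier A → Carrier B) : Set₁ where
  field
    h-cong : ∀ {x y} → _≈_ A x y → _≈_ B (h x) (h y)
    h-∩    : ∀ x y → _≈_ B (h (_∩_ A x y)) (_∩_ B (h x) (h y))
    h-∼    : ∀ x → _≈_ B (h (∼_ A x)) (∼_ B (h x))
    h-S    : ∀ i j (p : i ≢ j) x → _≈_ B (h (S A i j p x)) (S B i j p (h x))

Embeds : {n : ℕ} → TA n → TA n → Set₁
Embeds A B = Σ (Carrier A → Carrier B) λ h →
  IsHom A B h × (∀ x y → _≈_ B (h x) (h y) → _≈_ A x y)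

HomImage : {n : ℕ} → TA n → TA n → Set₁
HomImage A B = Σ (Carrier A → Carrier B) λ h →
  IsHom A B h × (∀ b → Σ (Carrier A) λ a → _≈_ B (h a) b)

-- The full transposition set algebra of dimension n with base U:
-- carrier P(ⁿU) (predicates on Fin n → U), equality = extensional equality of sets.
FullSetTA : (n : ℕ) → Set → TA n
FullSetTA n U = record
  { Carrier = (Fin n → U) → Set
  ; _≈_ = λ X Y → ∀ q → (X q → Y q) × (Y q → X q)
  ; isEquivalence = record
      { refl  = λ q → (λ z → z) , (λ z → z)
      ; sym   = λ e q → let (f , g) = e q in g , f
      ; trans = λ e e' q → let (f , g) = e q ; (f' , g') = e' q in (f' ∘ f) , (g ∘ g')
      }
  ; _∩_ = λ X Y q → X q × Y q
  ; ∼_  = λ X q → ¬ X q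
  ; S   = λ i j _ X q → X (q ∘ transpose i j)
  ; ∩-cong = λ ex ey q → let (f , g) = ex q ; (f' , g') = ey q in
               (λ { (a , b) → f a , f' b }) , (λ { (a , b) → g a , g' b })
  ; ∼-cong = λ ex q → let (f , g) = ex q in (λ nx y → nx (g y)) , (λ ny x → ny (f x))
  ; S-cong = λ i j _ ex q → ex (q ∘ transpose i j)
  }

Product : {n : ℕ} (I : Set) → (I → TA n) → TA n
Product I B = record
  { Carrier = (i : I) → Carrier (B i)
  ; _≈_ = λ x y → ∀ i → _≈_ (B i) (x i) (y i)
  ; isEquivalence = record
      { refl  = λ i → IsEquivalence.refl (isEquivalence (B i))
      ; sym   = λ e i → IsEquivalence.sym (isEquivalence (B i)) (e i)
      ; trans = λ e e' i → IsEquivalence.trans (isEquivalence (B i)) (e i) (e' i)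
      }
  ; _∩_ = λ x y i → _∩_ (B i) (x i) (y i)
  ; ∼_  = λ x i → ∼_ (B i) (x i)
  ; S   = λ a b p x i → S (B i) a b p (x i)
  ; ∩-cong = λ ex ey i → ∩-cong (B i) (ex i) (ey i)
  ; ∼-cong = λ ex i → ∼-cong (B i) (ex i)
  ; S-cong = λ a b p ex i → S-cong (B i) a b p (ex i)
  }

-- SetTA_n: (isomorphic copies of) subalgebras of full transposition set algebras.
InSetTA : {n : ℕ} → TA n → Set₁
InSetTA {n} A = Σ Set λ U → Embeds A (FullSetTA n U)

-- RTA_n = SP SetTA_n: (isomorphic copies of) subalgebras of direct products
-- of members of SetTA_n.
InRTA : {n : ℕ} → TA n → Set₂
InRTA {n} A = Σ Set λ I → Σ (I → TA n) λ B →
  ((i : I) → InSetTA (B i)) × Embeds A (Product I B)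

ClosedUnderH : {n : ℕ} → (TA n → Set₂) → Set₂
ClosedUnderH {n} K = (A B : TA n) → K A → HomImage A B → K B

-- In a set algebra with nonempty base, S_ij X and ∼X differ at every constant
-- sequence, so every member of RTA_n satisfies the quasi-equation
-- S_ij x = ∼x → y = z, and this quasi-equation is preserved by subalgebras and
-- products. But in the homomorphic image of P(ⁿℕ) obtained by comparing sets
-- only on injective sequences, X = {q : q 0 < q 1} satisfies S_01 X = ∼X while
-- the image is nontrivial.
module Submission where

open import Defs
open import Level using (0ℓ) renaming (suc to lsuc)
open import Data.Nat using (ℕ; suc; _≥_; _<_; s≤s; z≤n)
open import Data.Nat.Properties using (<-cmp; <-asym)
open import Data.Fin using (Fin; toℕ; zero; suc)
open import Data.Fin.Properties using (toℕ-injective)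
open import Data.Fin.Permutation.Components using (transpose; transpose-inverse)
open import Data.Product using (_×_; _,_)
open import Data.Unit using (⊤; tt)
open import Data.Empty using (⊥; ⊥-elim)
open import Function using (id; _∘_)
open import Function.Definitions using (Injective)
import Function.Construct.Composition as Compose
open import Relation.Binary using (Setoid; tri<; tri≈; tri>)
open import Relation.Binary.PropositionalEquality using (_≡_; _≢_; sym; cong; module ≡-Reasoning)
open import Relation.Binary.Structures using (IsEquivalence)
import Relation.Binary.Reasoning.Setoid as SetoidReasoning
open import Relation.Nullary using (¬_)

open TA

setoid : ∀ {n} → TA n → Setoid (lsuc 0ℓ) 0ℓ
setoid A = record { isEquivalence = isEquivalence A }

Trivial : ∀ {n} → TA n → Set₁
Trivial A = ∀ x y → _≈_ A x y

id-isHom : ∀ {n} (A : TA n) → IsHom A A id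
id-isHom A = record
  { h-cong = id
  ; h-∩    = λ _ _ → refl
  ; h-∼    = λ _ → refl
  ; h-S    = λ _ _ _ _ → refl
  }
  where open IsEquivalence (isEquivalence A)

embeds-refl : ∀ {n} (A : TA n) → Embeds A A
embeds-refl A = id , id-isHom A , λ _ _ → id

embeds-diagonal : ∀ {n} (A : TA n) → Embeds A (Product ⊤ λ _ → A)
embeds-diagonal A = (λ x _ → x) , diagonal-isHom , λ _ _ e → e tt
  where
  open IsEquivalence (isEquivalence A)
  diagonal-isHom : IsHom A (Product ⊤ λ _ → A) (λ x _ → x)
  diagonal-isHom = record
    { h-cong = λ e _ → e
    ; h-∩    = λ _ _ _ → refl
    ; h-∼    = λ _ _ → refl
    ; h-S    = λ _ _ _ _ _ → refl
    }

fullSetTA∈SetTA : ∀ {n} (U : Set) → InSetTA (FullSetTA n U)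
fullSetTA∈SetTA U = U , embeds-refl _

SetTA⊆RTA : ∀ {n} {A : TA n} → InSetTA A → InRTA A
SetTA⊆RTA {A = A} A∈SetTA = ⊤ , (λ _ → A) , (λ _ → A∈SetTA) , embeds-diagonal A

module _ {n : ℕ} (i j : Fin n) (i≢j : i ≢ j) where

  IsSwapComplement : (A : TA n) → Carrier A → Set
  IsSwapComplement A x = _≈_ A (S A i j i≢j x) (∼_ A x)

  SwapComplementCollapses : TA n → Set₁
  SwapComplementCollapses A = ∀ x → IsSwapComplement A x → Trivial A

  isHom-preserves-isSwapComplement : ∀ {A B h} → IsHom A B h →
    ∀ {x} → IsSwapComplement A x → IsSwapComplement B (h x)
  isHom-preserves-isSwapComplement {A} {B} {h} h-isHom {x} Sx≈∼x = begin
    S B i j i≢j (h x)  ≈⟨ ≈-sym (h-S i j i≢j x) ⟩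
    h (S A i j i≢j x)  ≈⟨ h-cong Sx≈∼x ⟩
    h (∼_ A x)         ≈⟨ h-∼ x ⟩
    ∼_ B (h x)         ∎
    where
    open IsHom h-isHom
    open SetoidReasoning (setoid B)
    open IsEquivalence (isEquivalence B) using () renaming (sym to ≈-sym)

  -- A constant sequence is fixed by every transposition, so it would lie in
  -- X exactly when it does not; hence ⁿU has no points at all.
  fullSetTA-swapComplementCollapses : ∀ U → SwapComplementCollapses (FullSetTA n U)
  fullSetTA-swapComplementCollapses U X SX≈∼X _ _ q with SX≈∼X (λ _ → q i)
  ... | SX⇒∼X , ∼X⇒SX = ⊥-elim (∉X (∼X⇒SX ∉X))
    where ∉X = λ x → SX⇒∼X x x

  embeds-reflects-swapComplementCollapses : ∀ {A B} → Embeds A B →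
    SwapComplementCollapses B → SwapComplementCollapses A
  embeds-reflects-swapComplementCollapses (h , h-isHom , h-reflects) B-collapses x Sx≈∼x y z =
    h-reflects y z (B-collapses (h x) (isHom-preserves-isSwapComplement h-isHom Sx≈∼x) (h y) (h z))

  product-swapComplementCollapses : ∀ I (B : I → TA n) →
    (∀ k → SwapComplementCollapses (B k)) → SwapComplementCollapses (Product I B)
  product-swapComplementCollapses I B B-collapses x Sx≈∼x y z k =
    B-collapses k (x k) (Sx≈∼x k) (y k) (z k)

  RTA-swapComplementCollapses : ∀ {A} → InRTA A → SwapComplementCollapses A
  RTA-swapComplementCollapses (I , B , B∈SetTA , A↪ΠB) =
    embeds-reflects-swapComplementCollapses A↪ΠB
      (product-swapComplementCollapses I B λ k →
        let (U , Bk↪P) = B∈SetTA k in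
        embeds-reflects-swapComplementCollapses Bk↪P (fullSetTA-swapComplementCollapses U))

transpose-injective : ∀ {n} (i j : Fin n) → Injective _≡_ _≡_ (transpose i j)
transpose-injective i j {a} {b} ta≡tb = begin
  a                                ≡⟨ sym (transpose-inverse j i) ⟩
  transpose j i (transpose i j a)  ≡⟨ cong (transpose j i) ta≡tb ⟩
  transpose j i (transpose i j b)  ≡⟨ transpose-inverse j i ⟩
  b                                ∎
  where open ≡-Reasoning

InjectiveQuotient : (n : ℕ) → Set → TA n
InjectiveQuotient n U = record
  { Carrier = (Fin n → U) → Set
  ; _≈_ = λ X Y → ∀ q → Injective _≡_ _≡_ q → (X q → Y q) × (Y q → X q)
  ; isEquivalence = record
      { refl  = λ _ _ → id , id
      ; sym   = λ e q q-inj → let (f , g) = e q q-inj in g , f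
      ; trans = λ e e' q q-inj → let (f , g) = e q q-inj ; (f' , g') = e' q q-inj in
                  f' ∘ f , g ∘ g'
      }
  ; _∩_ = λ X Y q → X q × Y q
  ; ∼_  = λ X q → ¬ X q
  ; S   = λ i j _ X q → X (q ∘ transpose i j)
  ; ∩-cong = λ ex ey q q-inj → let (f , g) = ex q q-inj ; (f' , g') = ey q q-inj in
               (λ (a , b) → f a , f' b) , (λ (a , b) → g a , g' b)
  ; ∼-cong = λ ex q q-inj → let (f , g) = ex q q-inj in
               (λ ∉X y → ∉X (g y)) , (λ ∉Y x → ∉Y (f x))
  ; S-cong = λ i j _ ex q q-inj →
               ex (q ∘ transpose i j) (Compose.injective _≡_ _≡_ _≡_ (transpose-injective i j) q-inj)
  }

fullSetTA↠injectiveQuotient : ∀ {n} U → HomImage (FullSetTA n U) (InjectiveQuotient n U)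
fullSetTA↠injectiveQuotient {n} U = id , quotient-isHom , λ X → X , refl
  where
  open IsEquivalence (isEquivalence (InjectiveQuotient n U))
  quotient-isHom : IsHom (FullSetTA n U) (InjectiveQuotient n U) id
  quotient-isHom = record
    { h-cong = λ e q _ → e q
    ; h-∩    = λ _ _ → refl
    ; h-∼    = λ _ → refl
    ; h-S    = λ _ _ _ _ → refl
    }

injectiveQuotient-nontrivial : ∀ {n U} (q : Fin n → U) → Injective _≡_ _≡_ q →
  ¬ Trivial (InjectiveQuotient n U)
injectiveQuotient-nontrivial q q-inj trivial =
  let (⊤⇒⊥ , _) = trivial (λ _ → ⊤) (λ _ → ⊥) q q-inj in ⊤⇒⊥ tt

0≢1 : ∀ {m} → zero {suc m} ≢ suc zero
0≢1 ()

Increasing01 : ∀ {m} → (Fin (suc (suc m)) → ℕ) → Set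
Increasing01 q = q zero < q (suc zero)

increasing01-isSwapComplement : ∀ m →
  IsSwapComplement zero (suc zero) 0≢1 (InjectiveQuotient (suc (suc m)) ℕ) Increasing01
increasing01-isSwapComplement m q q-inj = (λ q₁<q₀ q₀<q₁ → <-asym q₀<q₁ q₁<q₀) , q₁<q₀
  where
  q₁<q₀ : ¬ q zero < q (suc zero) → q (suc zero) < q zero
  q₁<q₀ q₀≮q₁ with <-cmp (q zero) (q (suc zero))
  ... | tri< q₀<q₁ _ _ = ⊥-elim (q₀≮q₁ q₀<q₁)
  ... | tri≈ _ q₀≡q₁ _ = ⊥-elim (0≢1 (q-inj q₀≡q₁))
  ... | tri> _ _ q₁<q₀ = q₁<q₀

mainTheorem4 : (n : ℕ) → n ≥ 2 → ¬ ClosedUnderH {n} InRTA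
mainTheorem4 (suc (suc m)) (s≤s (s≤s z≤n)) RTA-closedUnderH =
  injectiveQuotient-nontrivial toℕ toℕ-injective
    (RTA-swapComplementCollapses zero (suc zero) 0≢1 quotient∈RTA
      Increasing01 (increasing01-isSwapComplement m))
  where
  quotient∈RTA : InRTA (InjectiveQuotient (suc (suc m)) ℕ)
  quotient∈RTA = RTA-closedUnderH _ _ (SetTA⊆RTA (fullSetTA∈SetTA ℕ)) (fullSetTA↠injectiveQuotient ℕ)
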